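{- Let $A\in\{61,67,77,83\}$. Then there is no binary sequence $\mathbf a$ of period $n=\tfrac14(A^2+3)$ with $C_{\mathbf a}(t)=3$ for all $1\le t\le n-1$.
   Context: A binary sequence of period $n$ is $\mathbf a=(a_0,a_1,\ldots)$ with $a_j\in\{ -1,1\}$ and $a_{j+n}=a_j$ for all $j\ge0$; its autocorrelation values are $C_{\mathbf a}(t)=\sum_{i=0}^{n-1}a_ia_{i+t}$. -}

module Defs where

open import Data.Nat as ℕ using (ℕ; zero; suc)
open import Data.Integer using (ℤ; +_; -[1+_]; _+_; _*_)
open import Data.Sum using (_⊎_)
open import Relation.Binary.PropositionalEquality using (_≡_)

IsBinary : (ℕ → ℤ) → Set
IsBinary a = ∀ j → a j ≡ -[1+ 0 ] ⊎ a j ≡ + 1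

HasPeriod : ℕ → (ℕ → ℤ) → Set
HasPeriod n a = ∀ j → a (j ℕ.+ n) ≡ a j

sumTo : ℕ → (ℕ → ℤ) → ℤ
sumTo zero    f = + 0
sumTo (suc n) f = sumTo n f + f n

autocorr : ℕ → (ℕ → ℤ) → ℕ → ℤ
autocorr n a t = sumTo n (λ i → a i * a (i ℕ.+ t))

module Submission where

-- Write m = 2p + 1 for an odd modulus in which -1 is a power of 2.
--   (1) Over F₂, the group algebra F₂[ℤ/m] satisfies u² = u(x²) (Frobenius).
--       Hence if -1 ≡ 2^e (mod m) and g(x)·g(x⁻¹) = 0, then g^(2^e + 1) = 0,
--       so the invertible power g^(2^(e+1)) vanishes and g = 0.
--   (2) If all autocorrelations of an integer sequence f of period m have the
--       same parity, then (1) applied to (f mod 2) + constant shows that f is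
--       constant mod 2: f = 2h + c, and the off-peak gaps of f are four times
--       those of h.  Iterating, no sequence can have all gaps C(0) - C(s) equal
--       to 2^(2k+1)·odd.
--   (3) Folding a binary sequence of period n = m·d to period m
--       (b_r = Σ_k a_(r + mk)) keeps the gap C(0) - C(s) equal to n - 3.
-- For each A we exhibit m (19 for n = 931 = 19·49, n itself otherwise), the
-- exponent e with (p+1)^e ≡ -1 (mod m), where p + 1 ≡ 2⁻¹, and n - 3 = 2^(2k+1)·o.

open import Relation.Binary.PropositionalEquality
  using (_≡_; refl; sym; trans; cong; cong₂; subst; _≗_; module ≡-Reasoning)

module Periodicity where

  open import Data.Nat using (ℕ; zero; suc; _+_; _*_; _%_; _/_; NonZero)
  open import Data.Nat.Properties using (+-identityʳ; *-zeroʳ; *-comm)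
  open import Data.Nat.DivMod using (m≡m%n+[m/n]*n)
  open import Data.Nat.Tactic.RingSolver using (solve-∀)

  Periodic : {A : Set} → ℕ → (ℕ → A) → Set
  Periodic m u = ∀ j → u (j + m) ≡ u j

  periodic-+* : ∀ {A : Set} {m} {u : ℕ → A} → Periodic m u → ∀ j k → u (j + m * k) ≡ u j
  periodic-+* {m = m} {u} per j zero = cong u (trans (cong (j +_) (*-zeroʳ m)) (+-identityʳ j))
  periodic-+* {m = m} {u} per j (suc k) =
    trans (cong u (one-more j m k)) (trans (per (j + m * k)) (periodic-+* per j k))
    where
    one-more : ∀ j m k → j + m * suc k ≡ j + m * k + m
    one-more = solve-∀

  periodic-≡ : ∀ {A : Set} {m} {u : ℕ → A} → Periodic m u →
               ∀ {x y} k → x ≡ y + m * k → u x ≡ u y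
  periodic-≡ {u = u} per {y = y} k x≡y+mk = trans (cong u x≡y+mk) (periodic-+* per y k)

  periodic-% : ∀ {A : Set} m .{{_ : NonZero m}} {u : ℕ → A} → Periodic m u → ∀ j → u j ≡ u (j % m)
  periodic-% m per j =
    periodic-≡ per (j / m) (trans (m≡m%n+[m/n]*n j m) (cong (j % m +_) (*-comm (j / m) m)))

module FiniteSums {A : Set} (_∙_ : A → A → A) (ε : A)
  (assoc : ∀ x y z → (x ∙ y) ∙ z ≡ x ∙ (y ∙ z))
  (comm : ∀ x y → x ∙ y ≡ y ∙ x)
  (identityˡ : ∀ x → ε ∙ x ≡ x)
  (cancelʳ : ∀ x y z → y ∙ x ≡ z ∙ x → y ≡ z) where

  open import Data.Nat using (ℕ; zero; suc; _+_; _*_; _∸_; _<_)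
  open import Data.Nat.Properties using (+-suc; +-identityʳ; +-assoc; +-comm; n<1+n; m<n⇒m<1+n)
  open Periodicity
  open ≡-Reasoning

  ∑ : ℕ → (ℕ → A) → A
  ∑ zero    f = ε
  ∑ (suc n) f = ∑ n f ∙ f n

  identityʳ : ∀ x → x ∙ ε ≡ x
  identityʳ x = trans (comm x ε) (identityˡ x)

  interchange : ∀ a b c d → (a ∙ b) ∙ (c ∙ d) ≡ (a ∙ c) ∙ (b ∙ d)
  interchange a b c d = begin
    (a ∙ b) ∙ (c ∙ d) ≡⟨ assoc a b (c ∙ d) ⟩
    a ∙ (b ∙ (c ∙ d)) ≡⟨ cong (a ∙_) (sym (assoc b c d)) ⟩
    a ∙ ((b ∙ c) ∙ d) ≡⟨ cong (λ z → a ∙ (z ∙ d)) (comm b c) ⟩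
    a ∙ ((c ∙ b) ∙ d) ≡⟨ cong (a ∙_) (assoc c b d) ⟩
    a ∙ (c ∙ (b ∙ d)) ≡⟨ sym (assoc a c (b ∙ d)) ⟩
    (a ∙ c) ∙ (b ∙ d) ∎

  ∑-cong : ∀ n {f g : ℕ → A} → (∀ i → f i ≡ g i) → ∑ n f ≡ ∑ n g
  ∑-cong zero    f≡g = refl
  ∑-cong (suc n) f≡g = cong₂ _∙_ (∑-cong n f≡g) (f≡g n)

  ∑-cong< : ∀ n {f g : ℕ → A} → (∀ i → i < n → f i ≡ g i) → ∑ n f ≡ ∑ n g
  ∑-cong< zero    f≡g = refl
  ∑-cong< (suc n) f≡g =
    cong₂ _∙_ (∑-cong< n (λ i i<n → f≡g i (m<n⇒m<1+n i<n))) (f≡g n (n<1+n n))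

  ∑-ε : ∀ n → ∑ n (λ _ → ε) ≡ ε
  ∑-ε zero    = refl
  ∑-ε (suc n) = trans (identityʳ _) (∑-ε n)

  ∑-∙ : ∀ n (f g : ℕ → A) → ∑ n (λ i → f i ∙ g i) ≡ ∑ n f ∙ ∑ n g
  ∑-∙ zero    f g = sym (identityˡ ε)
  ∑-∙ (suc n) f g = trans (cong (_∙ (f n ∙ g n)) (∑-∙ n f g)) (interchange _ _ _ _)

  ∑-hom : (h : A → A) → (∀ x y → h (x ∙ y) ≡ h x ∙ h y) → h ε ≡ ε →
          ∀ n f → ∑ n (λ i → h (f i)) ≡ h (∑ n f)
  ∑-hom h h-∙ h-ε zero    f = sym h-ε
  ∑-hom h h-∙ h-ε (suc n) f = trans (cong (_∙ h (f n)) (∑-hom h h-∙ h-ε n f)) (sym (h-∙ _ _))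

  ∑-swap : ∀ a b (f : ℕ → ℕ → A) → ∑ a (λ i → ∑ b (f i)) ≡ ∑ b (λ j → ∑ a (λ i → f i j))
  ∑-swap zero    b f = sym (∑-ε b)
  ∑-swap (suc a) b f = trans (cong (_∙ ∑ b (f a)) (∑-swap a b f)) (sym (∑-∙ b _ _))

  ∑-front : ∀ n f → ∑ (suc n) f ≡ f 0 ∙ ∑ n (λ i → f (suc i))
  ∑-front zero    f = trans (identityˡ _) (sym (identityʳ _))
  ∑-front (suc n) f = trans (cong (_∙ f (suc n)) (∑-front n f)) (assoc _ _ _)

  ∑-split : ∀ a b f → ∑ (a + b) f ≡ ∑ a f ∙ ∑ b (λ i → f (a + i))
  ∑-split a zero    f = trans (cong (λ k → ∑ k f) (+-identityʳ a)) (sym (identityʳ _))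
  ∑-split a (suc b) f = trans (cong (λ k → ∑ k f) (+-suc a b))
    (trans (cong (_∙ f (a + b)) (∑-split a b f)) (assoc _ _ _))

  ∑-blocks : ∀ c d φ → ∑ (d * c) φ ≡ ∑ d (λ k → ∑ c (λ r → φ (k * c + r)))
  ∑-blocks c zero    φ = refl
  ∑-blocks c (suc d) φ = begin
    ∑ (c + d * c) φ
      ≡⟨ ∑-split c (d * c) φ ⟩
    ∑ c φ ∙ ∑ (d * c) (λ i → φ (c + i))
      ≡⟨ cong (∑ c φ ∙_) (∑-blocks c d (λ i → φ (c + i))) ⟩
    ∑ c φ ∙ ∑ d (λ k → ∑ c (λ r → φ (c + (k * c + r))))
      ≡⟨ cong (∑ c φ ∙_) (∑-cong d (λ k → ∑-cong c (λ r → cong φ (sym (+-assoc c (k * c) r))))) ⟩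
    ∑ c φ ∙ ∑ d (λ k → ∑ c (λ r → φ (suc k * c + r)))
      ≡⟨ sym (∑-front d (λ k → ∑ c (λ r → φ (k * c + r)))) ⟩
    ∑ (suc d) (λ k → ∑ c (λ r → φ (k * c + r))) ∎

  ∑-reverse : ∀ n f → ∑ n f ≡ ∑ n (λ i → f (n ∸ suc i))
  ∑-reverse zero    f = refl
  ∑-reverse (suc n) f = trans (comm _ _) (trans (cong (f n ∙_) (∑-reverse n f))
    (sym (∑-front n (λ i → f (suc n ∸ suc i)))))

  ∑-rotate : ∀ m f → Periodic m f → ∑ m (λ i → f (suc i)) ≡ ∑ m f
  ∑-rotate m f per = cancelʳ (f 0) _ _ (begin
    ∑ m (λ i → f (suc i)) ∙ f 0 ≡⟨ comm _ _ ⟩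
    f 0 ∙ ∑ m (λ i → f (suc i)) ≡⟨ sym (∑-front m f) ⟩
    ∑ m f ∙ f m                 ≡⟨ cong (∑ m f ∙_) (per 0) ⟩
    ∑ m f ∙ f 0                 ∎)

  ∑-shift : ∀ m f → Periodic m f → ∀ c → ∑ m (λ i → f (i + c)) ≡ ∑ m f
  ∑-shift m f per zero    = ∑-cong m (λ i → cong f (+-identityʳ i))
  ∑-shift m f per (suc c) = begin
    ∑ m (λ i → f (i + suc c)) ≡⟨ ∑-cong m (λ i → cong f (+-suc i c)) ⟩
    ∑ m (λ i → g (suc i))     ≡⟨ ∑-rotate m g g-periodic ⟩
    ∑ m g                     ≡⟨ ∑-shift m f per c ⟩
    ∑ m f                     ∎
    where
    g : ℕ → A
    g i = f (i + c)
    g-periodic : Periodic m g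
    g-periodic j = trans (cong f (trans (+-assoc j m c)
      (trans (cong (j +_) (+-comm m c)) (sym (+-assoc j c m))))) (per (j + c))

import Data.Nat as ℕ
import Data.Nat.Properties as ℕP
import Data.Bool as Bool
import Data.Bool.Properties as BoolP
import Data.Integer as ℤ
import Data.Integer.Properties as ℤP
open import Algebra.Bundles using (CommutativeRing)
import Algebra.Properties.Group as GroupProperties

module XorSum = FiniteSums Bool._xor_ Bool.false BoolP.xor-assoc BoolP.xor-comm BoolP.xor-identityˡ
  (GroupProperties.∙-cancelʳ (CommutativeRing.+-group BoolP.xor-∧-commutativeRing))
module IntSum = FiniteSums ℤ._+_ (ℤ.+ 0) ℤP.+-assoc ℤP.+-comm ℤP.+-identityˡ
  (GroupProperties.∙-cancelʳ (CommutativeRing.+-group ℤP.+-*-commutativeRing))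

-- Boolean sequences as F₂-valued sequences (xor is addition, ∧ multiplication).
module GF2 where

  open import Data.Nat using (ℕ; zero; suc; _+_; _*_; _^_; _∸_; _<_; NonZero)
  open import Data.Nat.Properties
    using (+-suc; +-comm; +-identityʳ; *-zeroʳ; *-identityˡ; m≤n⇒∃[o]m+o≡n; m+n∸m≡n)
  open import Data.Bool using (Bool; false; _∧_; _xor_)
  open import Data.Bool.Properties
    using (xor-identityʳ; xor-same; ∧-comm; ∧-assoc; ∧-idem; ∧-zeroʳ; ∧-distribˡ-xor; ∧-distribʳ-xor)
  open import Data.Product using (_,_)
  open import Data.Nat.Tactic.RingSolver using (solve-∀)
  open Periodicity
  open XorSum
  open ≡-Reasoning

  corr₂ : ℕ → (ℕ → Bool) → ℕ → Bool
  corr₂ n g s = ∑ n (λ a → g a ∧ g (a + s))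

  ∑-∧ˡ : ∀ n f y → ∑ n (λ i → y ∧ f i) ≡ y ∧ ∑ n f
  ∑-∧ˡ n f y = ∑-hom (y ∧_) (∧-distribˡ-xor y) (∧-zeroʳ y) n f

  ∑-∧ʳ : ∀ n f y → ∑ n (λ i → f i ∧ y) ≡ ∑ n f ∧ y
  ∑-∧ʳ n f y = ∑-hom (_∧ y) (λ a b → ∧-distribʳ-xor y a b) refl n f

  ∑-const-odd : ∀ p b → ∑ (suc (p + p)) (λ _ → b) ≡ b
  ∑-const-odd p b = begin
    ∑ (suc (p + p)) (λ _ → b)  ≡⟨ ∑-front (p + p) (λ _ → b) ⟩
    b xor ∑ (p + p) (λ _ → b)  ≡⟨ cong (b xor_) (∑-split p p (λ _ → b)) ⟩
    b xor (∑ p (λ _ → b) xor ∑ p (λ _ → b))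
                               ≡⟨ cong (b xor_) (xor-same (∑ p (λ _ → b))) ⟩
    b xor false                ≡⟨ xor-identityʳ b ⟩
    b                          ∎

  -- Over F₂, if f takes equal values at mirror positions d and m - d of
  -- {1, …, m - 1} (m = 2p + 1), these terms cancel in pairs and only f 0 remains.
  ∑-palindrome : ∀ p f → (∀ d e → suc (d + e) ≡ p + p → f (suc d) ≡ f (suc e)) →
                 ∑ (suc (p + p)) f ≡ f 0
  ∑-palindrome p f mirror = begin
    ∑ (suc (p + p)) f                                       ≡⟨ ∑-front (p + p) f ⟩
    f 0 xor ∑ (p + p) (λ i → f (suc i))                     ≡⟨ cong (f 0 xor_) (∑-split p p _) ⟩
    f 0 xor (lower-half xor ∑ p (λ i → f (suc (p + i))))  ≡⟨ cong (λ z → f 0 xor (lower-half xor z)) upper≡lower ⟩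
    f 0 xor (lower-half xor lower-half)                     ≡⟨ cong (f 0 xor_) (xor-same lower-half) ⟩
    f 0 xor false                                           ≡⟨ xor-identityʳ _ ⟩
    f 0                                                     ∎
    where
    lower-half : Bool
    lower-half = ∑ p (λ i → f (suc i))

    rearrange : ∀ i p k → suc (i + (p + k)) ≡ p + (suc i + k)
    rearrange = solve-∀

    paired : ∀ i → i < p → f (suc (p + (p ∸ suc i))) ≡ f (suc i)
    paired i i<p with m≤n⇒∃[o]m+o≡n i<p
    ... | k , i+1+k≡p = trans (cong (λ z → f (suc (p + z))) p∸[i+1]≡k)
                              (sym (mirror i (p + k) (trans (rearrange i p k) (cong (p +_) i+1+k≡p))))
      where
      p∸[i+1]≡k : p ∸ suc i ≡ k
      p∸[i+1]≡k = trans (cong (_∸ suc i) (sym i+1+k≡p)) (m+n∸m≡n (suc i) k)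

    upper≡lower : ∑ p (λ i → f (suc (p + i))) ≡ lower-half
    upper≡lower = trans (∑-reverse p _) (∑-cong< p paired)

  -- The group algebra F₂[ℤ/m] for m = 2p + 1: m-periodic boolean sequences under
  -- cyclic convolution.  As 2p ≡ -1 (mod m), (u ⋆ v)(s) = Σ_a u(a) v(s - a).
  module Convolution (p : ℕ) where

    m : ℕ
    m = suc (p + p)

    _⋆_ : (ℕ → Bool) → (ℕ → Bool) → ℕ → Bool
    (u ⋆ v) s = ∑ m (λ a → u a ∧ v (s + (p + p) * a))

    private
      shift-by-m : ∀ p s a → s + suc (p + p) + (p + p) * a ≡ s + (p + p) * a + suc (p + p) * 1
      shift-by-m = solve-∀

      reflect-by-m : ∀ p s a → s + (p + p) * (a + suc (p + p)) ≡ s + (p + p) * a + suc (p + p) * (p + p)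
      reflect-by-m = solve-∀

    ⋆-periodic : ∀ u {v} → Periodic m v → Periodic m (u ⋆ v)
    ⋆-periodic u per s = ∑-cong m (λ a → cong (u a ∧_) (periodic-≡ per 1 (shift-by-m p s a)))

    ⋆-cong : ∀ {u u' v v'} → u ≗ u' → v ≗ v' → u ⋆ v ≗ u' ⋆ v'
    ⋆-cong u≗u' v≗v' s = ∑-cong m (λ a → cong₂ _∧_ (u≗u' a) (v≗v' _))

    ⋆-zeroʳ : ∀ u {v} → v ≗ (λ _ → false) → u ⋆ v ≗ (λ _ → false)
    ⋆-zeroʳ u v≗0 s = trans (∑-cong m (λ a → trans (cong (u a ∧_) (v≗0 _)) (∧-zeroʳ (u a)))) (∑-ε m)

    ⋆-assoc : ∀ u {v w} → Periodic m v → Periodic m w → (u ⋆ v) ⋆ w ≗ u ⋆ (v ⋆ w)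
    ⋆-assoc u {v} {w} per-v per-w s = begin
      ∑ m (λ c → ∑ m (λ a → u a ∧ v (c + (p + p) * a)) ∧ w (s + (p + p) * c))
        ≡⟨ ∑-cong m (λ c → sym (∑-∧ʳ m _ _)) ⟩
      ∑ m (λ c → ∑ m (λ a → (u a ∧ v (c + (p + p) * a)) ∧ w (s + (p + p) * c)))
        ≡⟨ ∑-swap m m _ ⟩
      ∑ m (λ a → ∑ m (λ c → (u a ∧ v (c + (p + p) * a)) ∧ w (s + (p + p) * c)))
        ≡⟨ ∑-cong m (λ a → trans (∑-cong m (λ c → ∧-assoc (u a) _ _)) (∑-∧ˡ m (χ a) (u a))) ⟩
      ∑ m (λ a → u a ∧ ∑ m (χ a))
        ≡⟨ ∑-cong m (λ a → cong (u a ∧_) (trans (sym (∑-shift m (χ a) (χ-periodic a) a))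
                                               (∑-cong m (χ-substitute a)))) ⟩
      ∑ m (λ a → u a ∧ ∑ m (λ b → v b ∧ w ((s + (p + p) * a) + (p + p) * b))) ∎
      where
      χ : ℕ → ℕ → Bool
      χ a c = v (c + (p + p) * a) ∧ w (s + (p + p) * c)

      χ-periodic : ∀ a → Periodic m (χ a)
      χ-periodic a c = cong₂ _∧_ (periodic-≡ per-v 1 (shift-by-m p c a))
                                 (periodic-≡ per-w (p + p) (reflect-by-m p s c))

      cancel : ∀ p b a → b + a + (p + p) * a ≡ b + suc (p + p) * a
      cancel = solve-∀

      regroup : ∀ p s b a → s + (p + p) * (b + a) ≡ (s + (p + p) * a) + (p + p) * b
      regroup = solve-∀

      χ-substitute : ∀ a b → χ a (b + a) ≡ v b ∧ w ((s + (p + p) * a) + (p + p) * b)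
      χ-substitute a b = cong₂ _∧_ (periodic-≡ per-v a (cancel p b a)) (cong w (regroup p s b a))

    -- If suc d + suc e = m, then (p + p)·(suc d) ≡ -(suc d) ≡ suc e (mod m).
    mirror : ∀ {u : ℕ → Bool} → Periodic m u → ∀ x d e → suc (d + e) ≡ p + p →
             u (x + (p + p) * suc d) ≡ u (x + suc e)
    mirror per x d e d+e+1≡2p = generalised (p + p) per x d e d+e+1≡2p
      where
      identity : ∀ x d e → x + suc (d + e) * suc d ≡ (x + suc e) + suc (suc (d + e)) * d
      identity = solve-∀

      generalised : ∀ n {u : ℕ → Bool} → Periodic (suc n) u → ∀ x d e → suc (d + e) ≡ n →
                    u (x + n * suc d) ≡ u (x + suc e)
      generalised .(suc (d + e)) per x d e refl = periodic-≡ per d (identity x d e)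

    -- Frobenius: squaring in F₂[ℤ/m] is u(x) ↦ u(x²), i.e. (u ⋆ u)(s) = u(s/2) with
    -- 1/2 ≡ p + 1.  The terms a and s - a of the convolution cancel in pairs.
    ⋆-square : ∀ {u : ℕ → Bool} → Periodic m u → u ⋆ u ≗ (λ s → u (suc p * s))
    ⋆-square {u} per s = begin
      ∑ m φ                            ≡⟨ sym (∑-shift m φ φ-periodic (suc p * s)) ⟩
      ∑ m (λ d → φ (d + suc p * s))    ≡⟨ ∑-cong m centred ⟩
      ∑ m ψ                            ≡⟨ ∑-palindrome p ψ ψ-mirror ⟩
      ψ 0                              ≡⟨ cong₂ _∧_ (cong u (+-identityʳ _))
                                            (cong u (trans (cong (suc p * s +_) (*-zeroʳ (p + p))) (+-identityʳ _))) ⟩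
      u (suc p * s) ∧ u (suc p * s)    ≡⟨ ∧-idem _ ⟩
      u (suc p * s)                    ∎
      where
      φ : ℕ → Bool
      φ a = u a ∧ u (s + (p + p) * a)

      φ-periodic : Periodic m φ
      φ-periodic a = cong₂ _∧_ (per a) (periodic-≡ per (p + p) (reflect-by-m p s a))

      -- ψ is φ re-centred at s/2
      ψ : ℕ → Bool
      ψ d = u (suc p * s + d) ∧ u (suc p * s + (p + p) * d)

      recentre : ∀ p s d → s + (p + p) * (d + suc p * s) ≡ (suc p * s + (p + p) * d) + suc (p + p) * (p * s)
      recentre = solve-∀

      centred : ∀ d → φ (d + suc p * s) ≡ ψ d
      centred d = cong₂ _∧_ (cong u (+-comm d (suc p * s))) (periodic-≡ per (p * s) (recentre p s d))

      ψ-mirror : ∀ d e → suc (d + e) ≡ p + p → ψ (suc d) ≡ ψ (suc e)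
      ψ-mirror d e d+e+1≡2p = trans
        (cong₂ _∧_ (sym (mirror per x e d (trans (cong suc (+-comm e d)) d+e+1≡2p))) (mirror per x d e d+e+1≡2p))
        (∧-comm (u (x + (p + p) * suc e)) (u (x + suc e)))
        where
        x : ℕ
        x = suc p * s

    -- pow g k = g ⋆ g ⋆ ⋯ ⋆ g with k + 1 factors.
    pow : (ℕ → Bool) → ℕ → ℕ → Bool
    pow g zero    = g
    pow g (suc k) = g ⋆ pow g k

    pow-periodic : ∀ {g} → Periodic m g → ∀ k → Periodic m (pow g k)
    pow-periodic per zero    = per
    pow-periodic per (suc k) = ⋆-periodic _ (pow-periodic per k)

    pow-+ : ∀ {g} → Periodic m g → ∀ a b → pow g (suc (a + b)) ≗ pow g a ⋆ pow g b
    pow-+ per zero    b i = refl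
    pow-+ {g} per (suc a) b i =
      trans (⋆-cong (λ _ → refl) (pow-+ per a b) i)
            (sym (⋆-assoc g (pow-periodic per a) (pow-periodic per b) i))

    pow-vanish : ∀ g k → pow g k ≗ (λ _ → false) → ∀ l → pow g (l + k) ≗ (λ _ → false)
    pow-vanish g k gᵏ≗0 zero    = gᵏ≗0
    pow-vanish g k gᵏ≗0 (suc l) = ⋆-zeroʳ g (pow-vanish g k gᵏ≗0 l)

    -- pred2^ j = 2^j - 1, so that pow g (pred2^ j) is g^(2^j).
    pred2^ : ℕ → ℕ
    pred2^ zero    = 0
    pred2^ (suc j) = suc (pred2^ j + pred2^ j)

    pow-2^ : ∀ {g} → Periodic m g → ∀ j i → pow g (pred2^ j) i ≡ g (suc p ^ j * i)
    pow-2^ {g} per zero    i = cong g (sym (*-identityˡ i))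
    pow-2^ {g} per (suc j) i = begin
      pow g (suc (pred2^ j + pred2^ j)) i    ≡⟨ pow-+ per (pred2^ j) (pred2^ j) i ⟩
      (pow g (pred2^ j) ⋆ pow g (pred2^ j)) i ≡⟨ ⋆-square (pow-periodic per (pred2^ j)) i ⟩
      pow g (pred2^ j) (suc p * i)           ≡⟨ pow-2^ per j (suc p * i) ⟩
      g (suc p ^ j * (suc p * i))            ≡⟨ cong g (reassociate (suc p ^ j) (suc p) i) ⟩
      g (suc p ^ suc j * i)                  ∎
      where
      reassociate : ∀ a b i → a * (b * i) ≡ (b * a) * i
      reassociate = solve-∀

  -- Let m = 2p + 1 with p ≥ 1, and suppose (p+1)^e ≡ -1 (mod m); since
  -- p + 1 ≡ 1/2 this says that -1 is a power of 2 modulo m.  Then a periodic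
  -- boolean sequence g with vanishing mod-2 autocorrelations, i.e. with
  -- g(x)·g(x⁻¹) = 0 in F₂[ℤ/m], is identically false: g(x⁻¹) = g^(2^e), so
  -- g^(2^e + 1) = 0, hence g^(2^(e+1)) = 0, and this power is g up to an
  -- invertible change of variable.
  corr₂-vanishing : ∀ p .{{_ : NonZero p}} e t → suc p ^ e ≡ p + p + suc (p + p) * t →
    ∀ g → Periodic (suc (p + p)) g → (∀ s → corr₂ (suc (p + p)) g s ≡ false) → ∀ x → g x ≡ false
  corr₂-vanishing (suc q) e t inverse-power g per corr₂≡0 x = begin
    g x                                  ≡⟨ sym (periodic-≡ per quotient recover-x) ⟩
    g (suc p ^ suc e * y)                ≡⟨ sym (pow-2^ per (suc e) y) ⟩
    pow g (pred2^ (suc e)) y             ≡⟨ cong (λ k → pow g k y) (sym (+-suc (pred2^ e) (pred2^ e))) ⟩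
    pow g (pred2^ e + suc (pred2^ e)) y  ≡⟨ pow-vanish g _ next-vanishes (pred2^ e) y ⟩
    false                                ∎
    where
    p : ℕ
    p = suc q
    open Convolution p

    reflect : ℕ → Bool
    reflect i = g ((p + p) * i)

    unfold-t : ∀ a b t i → (a + b * t) * i ≡ a * i + b * (t * i)
    unfold-t = solve-∀

    reversed : pow g (pred2^ e) ≗ reflect
    reversed i = trans (pow-2^ per e i)
      (periodic-≡ per (t * i) (trans (cong (_* i) inverse-power) (unfold-t (p + p) m t i)))

    -- (2p)² ≡ 1 (mod m)
    square-of-2p : ∀ q s a → let p = suc q in
      (p + p) * (s + (p + p) * a) ≡ (a + (p + p) * s) + suc (p + p) * (suc (q + q) * a)
    square-of-2p = solve-∀

    annihilates : g ⋆ reflect ≗ (λ _ → false)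
    annihilates s = trans
      (∑-cong m (λ a → cong (g a ∧_) (periodic-≡ per (suc (q + q) * a) (square-of-2p q s a))))
      (corr₂≡0 ((p + p) * s))

    next-vanishes : pow g (suc (pred2^ e)) ≗ (λ _ → false)
    next-vanishes i = trans (⋆-cong (λ _ → refl) reversed i) (annihilates i)

    y : ℕ
    y = (p + p + p + p) * x

    -- (p + 1)·(2p)·(4p) ≡ 1 (mod m)
    inverse : ∀ q t x → let p = suc q in
      suc p * (p + p + suc (p + p) * t) * ((p + p + p + p) * x)
        ≡ x + suc (p + p) * (((p + p) * (p + p) + (p + q)) * x + suc p * t * ((p + p + p + p) * x))
    inverse = solve-∀

    quotient : ℕ
    quotient = ((p + p) * (p + p) + (p + q)) * x + suc p * t * y

    recover-x : suc p ^ suc e * y ≡ x + m * quotient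
    recover-x = trans (cong (λ z → suc p * z * y) inverse-power) (inverse q t x)

module Parity where

  open import Data.Nat using (zero; suc)
  open import Data.Integer using (ℤ; +_; _+_; _*_; _-_; ∣_∣)
  open import Data.Integer.Properties using (abs-*; +-identityʳ)
  open import Data.Integer.DivMod using (_%ℕ_; _/ℕ_; a≡a%ℕn+[a/ℕn]*n; n%ℕd<d)
  open import Data.Integer.Tactic.RingSolver using (solve-∀)
  open import Data.Bool using (Bool; true; false; _∧_; _xor_)
  open import Data.Product using (Σ; _,_; proj₁; proj₂)
  open import Data.Empty using (⊥; ⊥-elim)
  open ≡-Reasoning

  ⟦_⟧ : Bool → ℤ
  ⟦ false ⟧ = + 0
  ⟦ true  ⟧ = + 1

  infix 4 _≡₂_
  _≡₂_ : ℤ → Bool → Set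
  x ≡₂ b = Σ ℤ λ h → x ≡ + 2 * h + ⟦ b ⟧

  even≢odd : ∀ h h' → + 2 * h ≡ + 2 * h' + + 1 → ⊥
  even≢odd h h' 2h≡2h'+1 =
    ℕP.even≢odd ∣ h - h' ∣ 0 (sym (trans (cong ∣_∣ 1≡2[h-h']) (abs-* (+ 2) (h - h'))))
    where
    isolate : ∀ a b → + 2 * a - + 2 * b ≡ + 2 * (a - b)
    isolate = solve-∀
    one : ∀ b → + 1 ≡ (+ 2 * b + + 1) - + 2 * b
    one = solve-∀
    1≡2[h-h'] : + 1 ≡ + 2 * (h - h')
    1≡2[h-h'] = trans (one h') (trans (cong (_- + 2 * h') (sym 2h≡2h'+1)) (isolate h h'))

  ≡₂-unique : ∀ {x b c} → x ≡₂ b → x ≡₂ c → b ≡ c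
  ≡₂-unique {b = false} {false} _ _ = refl
  ≡₂-unique {b = true}  {true}  _ _ = refl
  ≡₂-unique {b = false} {true}  (h , x≡2h) (h' , x≡2h'+1) =
    ⊥-elim (even≢odd h h' (trans (sym (+-identityʳ _)) (trans (sym x≡2h) x≡2h'+1)))
  ≡₂-unique {b = true}  {false} (h , x≡2h+1) (h' , x≡2h') =
    ⊥-elim (even≢odd h' h (trans (sym (+-identityʳ _)) (trans (sym x≡2h') x≡2h+1)))

  private
    remainder-first : ∀ r a → r + a * + 2 ≡ + 2 * a + r
    remainder-first = solve-∀

  -- Every integer has a parity, obtained from division by 2.  (Kept abstract: only
  -- its specification is ever used.)
  abstract
    ≡₂-exists : ∀ x → Σ Bool (x ≡₂_)
    ≡₂-exists x with x %ℕ 2 | a≡a%ℕn+[a/ℕn]*n x 2 | n%ℕd<d x 2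
    ... | 0           | x≡r+2q | _ = false , x /ℕ 2 , trans x≡r+2q (remainder-first (+ 0) (x /ℕ 2))
    ... | 1           | x≡r+2q | _ = true  , x /ℕ 2 , trans x≡r+2q (remainder-first (+ 1) (x /ℕ 2))
    ... | suc (suc _) | _      | ℕ.s≤s (ℕ.s≤s ())

  parity : ℤ → Bool
  parity x = proj₁ (≡₂-exists x)

  parity-≡₂ : ∀ x → x ≡₂ parity x
  parity-≡₂ x = proj₂ (≡₂-exists x)

  parity-unique : ∀ {x b} → x ≡₂ b → parity x ≡ b
  parity-unique = ≡₂-unique (parity-≡₂ _)

  ⟦xor⟧ : ∀ b c → ⟦ b xor c ⟧ + + 2 * ⟦ b ∧ c ⟧ ≡ ⟦ b ⟧ + ⟦ c ⟧
  ⟦xor⟧ false false = refl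
  ⟦xor⟧ false true  = refl
  ⟦xor⟧ true  false = refl
  ⟦xor⟧ true  true  = refl

  ⟦∧⟧ : ∀ b c → ⟦ b ∧ c ⟧ ≡ ⟦ b ⟧ * ⟦ c ⟧
  ⟦∧⟧ false false = refl
  ⟦∧⟧ false true  = refl
  ⟦∧⟧ true  false = refl
  ⟦∧⟧ true  true  = refl

  ≡₂-+ : ∀ {x y b c} → x ≡₂ b → y ≡₂ c → x + y ≡₂ (b xor c)
  ≡₂-+ {b = b} {c = c} (h , refl) (h' , refl) = h + h' + ⟦ b ∧ c ⟧ , (begin
      (+ 2 * h + ⟦ b ⟧) + (+ 2 * h' + ⟦ c ⟧)             ≡⟨ collect h h' ⟦ b ⟧ ⟦ c ⟧ ⟩
      + 2 * (h + h') + (⟦ b ⟧ + ⟦ c ⟧)                   ≡⟨ cong (λ z → + 2 * (h + h') + z) (sym (⟦xor⟧ b c)) ⟩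
      + 2 * (h + h') + (⟦ b xor c ⟧ + + 2 * ⟦ b ∧ c ⟧)  ≡⟨ carry h h' ⟦ b xor c ⟧ ⟦ b ∧ c ⟧ ⟩
      + 2 * (h + h' + ⟦ b ∧ c ⟧) + ⟦ b xor c ⟧          ∎)
    where
    collect : ∀ h h' β γ → (+ 2 * h + β) + (+ 2 * h' + γ) ≡ + 2 * (h + h') + (β + γ)
    collect = solve-∀
    carry : ∀ h h' ξ δ → + 2 * (h + h') + (ξ + + 2 * δ) ≡ + 2 * (h + h' + δ) + ξ
    carry = solve-∀

  ≡₂-* : ∀ {x y b c} → x ≡₂ b → y ≡₂ c → x * y ≡₂ (b ∧ c)
  ≡₂-* {b = b} {c = c} (h , refl) (h' , refl) = + 2 * h * h' + h * ⟦ c ⟧ + ⟦ b ⟧ * h' , (begin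
      (+ 2 * h + ⟦ b ⟧) * (+ 2 * h' + ⟦ c ⟧)
        ≡⟨ expand h h' ⟦ b ⟧ ⟦ c ⟧ ⟩
      + 2 * (+ 2 * h * h' + h * ⟦ c ⟧ + ⟦ b ⟧ * h') + ⟦ b ⟧ * ⟦ c ⟧
        ≡⟨ cong (λ z → + 2 * (+ 2 * h * h' + h * ⟦ c ⟧ + ⟦ b ⟧ * h') + z) (sym (⟦∧⟧ b c)) ⟩
      + 2 * (+ 2 * h * h' + h * ⟦ c ⟧ + ⟦ b ⟧ * h') + ⟦ b ∧ c ⟧ ∎)
    where
    expand : ∀ h h' β γ → (+ 2 * h + β) * (+ 2 * h' + γ) ≡ + 2 * (+ 2 * h * h' + h * γ + β * h') + β * γ
    expand = solve-∀

  ≡₂-+even : ∀ {x b} → x ≡₂ b → ∀ y → x + + 2 * y ≡₂ b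
  ≡₂-+even {b = b} (h , refl) y = h + y , shift h y ⟦ b ⟧
    where
    shift : ∀ h y β → + 2 * h + β + + 2 * y ≡ + 2 * (h + y) + β
    shift = solve-∀

  ≡₂-∑ : ∀ n f → IntSum.∑ n f ≡₂ XorSum.∑ n (λ i → parity (f i))
  ≡₂-∑ zero    f = + 0 , refl
  ≡₂-∑ (suc n) f = ≡₂-+ (≡₂-∑ n f) (parity-≡₂ (f n))

module Autocorrelation where

  open import Data.Nat using (ℕ; zero; suc)
  open import Data.Integer using (ℤ; +_; _+_; _*_; _-_)
  open import Data.Integer.Properties using (*-distribˡ-+; *-distribʳ-+; *-zeroʳ; *-zeroˡ; pos-+)
  open import Data.Integer.Tactic.RingSolver using (solve-∀)
  open Periodicity
  open Parity
  open IntSum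
  open GF2 using (corr₂)
  open ≡-Reasoning

  C : ℕ → (ℕ → ℤ) → ℕ → ℤ
  C n f s = ∑ n (λ i → f i * f (i ℕ.+ s))

  ∑-scaleˡ : ∀ k n f → ∑ n (λ i → k * f i) ≡ k * ∑ n f
  ∑-scaleˡ k = ∑-hom (k *_) (*-distribˡ-+ k) (*-zeroʳ k)

  ∑-scaleʳ : ∀ k n f → ∑ n (λ i → f i * k) ≡ ∑ n f * k
  ∑-scaleʳ k = ∑-hom (_* k) (λ x y → *-distribʳ-+ k x y) (*-zeroˡ k)

  ∑-const : ∀ n k → ∑ n (λ _ → + k) ≡ + (n ℕ.* k)
  ∑-const zero    k = refl
  ∑-const (suc n) k = trans (cong (_+ + k) (∑-const n k))
    (trans (sym (pos-+ (n ℕ.* k) k)) (cong +_ (ℕP.+-comm (n ℕ.* k) k)))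

  C-periodic : ∀ n f → Periodic n f → Periodic n (C n f)
  C-periodic n f per s =
    ∑-cong n (λ i → cong (f i *_) (trans (cong f (sym (ℕP.+-assoc i s n))) (per (i ℕ.+ s))))

  C-parity : ∀ n f s → parity (C n f s) ≡ corr₂ n (λ i → parity (f i)) s
  C-parity n f s = trans (parity-unique (≡₂-∑ n _)) (XorSum.∑-cong n (λ i →
    parity-unique (≡₂-* (parity-≡₂ (f i)) (parity-≡₂ (f (i ℕ.+ s))))))

  C-gap-affine : ∀ n f h c → Periodic n h → (∀ i → f i ≡ + 2 * h i + c) →
                 ∀ s → C n f 0 - C n f s ≡ + 4 * (C n h 0 - C n h s)
  C-gap-affine n f h c per f≡2h+c s =
    trans (cong₂ _-_ (C-affine 0) (C-affine s)) (cancel-offset (C n h 0) (C n h s) offset)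
    where
    -- the part of C n f s that does not depend on s
    offset : ℤ
    offset = + 2 * c * ∑ n h + (+ 2 * c * ∑ n h + ∑ n (λ _ → c * c))

    expand : ∀ a b γ → (+ 2 * a + γ) * (+ 2 * b + γ) ≡ + 4 * (a * b) + (+ 2 * γ * b + (+ 2 * γ * a + γ * γ))
    expand = solve-∀

    cancel-offset : ∀ a b r → (+ 4 * a + r) - (+ 4 * b + r) ≡ + 4 * (a - b)
    cancel-offset = solve-∀

    C-affine : ∀ s → C n f s ≡ + 4 * C n h s + offset
    C-affine s = begin
      ∑ n (λ i → f i * f (i ℕ.+ s))
        ≡⟨ ∑-cong n (λ i → trans (cong₂ _*_ (f≡2h+c i) (f≡2h+c (i ℕ.+ s))) (expand (h i) (h (i ℕ.+ s)) c)) ⟩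
      ∑ n (λ i → + 4 * (h i * h (i ℕ.+ s)) + (+ 2 * c * h (i ℕ.+ s) + (+ 2 * c * h i + c * c)))
        ≡⟨ ∑-∙ n _ _ ⟩
      ∑ n (λ i → + 4 * (h i * h (i ℕ.+ s))) + ∑ n (λ i → + 2 * c * h (i ℕ.+ s) + (+ 2 * c * h i + c * c))
        ≡⟨ cong₂ _+_ (∑-scaleˡ (+ 4) n _) (∑-∙ n _ _) ⟩
      + 4 * C n h s + (∑ n (λ i → + 2 * c * h (i ℕ.+ s)) + ∑ n (λ i → + 2 * c * h i + c * c))
        ≡⟨ cong (λ z → + 4 * C n h s + z) (cong₂ _+_ shifted
             (trans (∑-∙ n _ _) (cong (_+ ∑ n (λ _ → c * c)) (∑-scaleˡ (+ 2 * c) n h)))) ⟩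
      + 4 * C n h s + offset ∎
      where
      shifted : ∑ n (λ i → + 2 * c * h (i ℕ.+ s)) ≡ + 2 * c * ∑ n h
      shifted = trans (∑-scaleˡ (+ 2 * c) n _) (cong (+ 2 * c *_) (∑-shift n h per s))

module Descent (p : ℕ.ℕ) .{{_ : ℕ.NonZero p}} (e t : ℕ.ℕ)
  (inverse-power : ℕ.suc p ℕ.^ e ≡ p ℕ.+ p ℕ.+ ℕ.suc (p ℕ.+ p) ℕ.* t) where

  open import Data.Nat using (ℕ; zero; suc; _+_; _≤_; _<_; s≤s; z≤n; _%_; >-nonZero⁻¹)
  open import Data.Nat.Properties using (≤-trans; m≤m+n)
  open import Data.Nat.DivMod using (m%n<n)
  open import Data.Integer as ℤ using (ℤ; +_; _*_; _-_; _^_)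
  open import Data.Integer.Properties using (*-cancelˡ-≡; *-identityˡ)
  open import Data.Integer.Tactic.RingSolver using (solve-∀)
  open import Data.Bool using (Bool; true; false; _∧_; _xor_)
  open import Data.Product using (Σ; _×_; _,_; proj₁; proj₂)
  open import Data.Empty using (⊥)
  open GroupProperties (CommutativeRing.+-group ℤP.+-*-commutativeRing) using (∙-cancelʳ)
  open Periodicity
  open Parity
  open GF2
  open XorSum
  open Autocorrelation
  open ≡-Reasoning

  m : ℕ
  m = suc (p + p)

  xor-≡false : ∀ a b → a xor b ≡ false → a ≡ b
  xor-≡false false false _ = refl
  xor-≡false true  true  _ = refl

  expand₂ : ∀ a b σ → (a xor σ) ∧ (b xor σ) ≡ ((a ∧ b) xor (σ ∧ a)) xor ((σ ∧ b) xor σ)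
  expand₂ false false false = refl
  expand₂ false false true  = refl
  expand₂ false true  false = refl
  expand₂ false true  true  = refl
  expand₂ true  false false = refl
  expand₂ true  false true  = refl
  expand₂ true  true  false = refl
  expand₂ true  true  true  = refl

  cancel-pairs : ∀ σ y → (σ xor y) xor (y xor σ) ≡ false
  cancel-pairs false false = refl
  cancel-pairs false true  = refl
  cancel-pairs true  false = refl
  cancel-pairs true  true  = refl

  -- If all autocorrelations of f have the same parity σ, then f ≡ σ (mod 2):
  -- the sequence g = (f mod 2) + σ has vanishing mod-2 autocorrelations.
  constant-mod-2 : ∀ f → Periodic m f → (∀ s → parity (C m f s) ≡ parity (C m f 0)) →
                   ∀ i → f i ≡₂ parity (C m f 0)
  constant-mod-2 f per same-parity i = subst (f i ≡₂_)
    (xor-≡false _ _ (corr₂-vanishing p e t inverse-power g g-periodic corr₂-g i)) (parity-≡₂ (f i))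
    where
    σ : Bool
    σ = parity (C m f 0)

    π : ℕ → Bool
    π i = parity (f i)

    π-periodic : Periodic m π
    π-periodic j = cong parity (per j)

    g : ℕ → Bool
    g i = π i xor σ

    g-periodic : Periodic m g
    g-periodic j = cong (_xor σ) (π-periodic j)

    corr₂-g : ∀ s → corr₂ m g s ≡ false
    corr₂-g s = begin
      ∑ m (λ i → (π i xor σ) ∧ (π (i + s) xor σ))
        ≡⟨ ∑-cong m (λ i → expand₂ (π i) (π (i + s)) σ) ⟩
      ∑ m (λ i → ((π i ∧ π (i + s)) xor (σ ∧ π i)) xor ((σ ∧ π (i + s)) xor σ))
        ≡⟨ trans (∑-∙ m _ _) (cong₂ _xor_ (∑-∙ m _ _) (∑-∙ m _ _)) ⟩
      (corr₂ m π s xor ∑ m (λ i → σ ∧ π i)) xor (∑ m (λ i → σ ∧ π (i + s)) xor ∑ m (λ _ → σ))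
        ≡⟨ cong₂ _xor_ (cong₂ _xor_ (trans (sym (C-parity m f s)) (same-parity s)) (∑-∧ˡ m π σ))
                       (cong₂ _xor_ (trans (∑-∧ˡ m _ σ) (cong (σ ∧_) (∑-shift m π π-periodic s)))
                                    (∑-const-odd p σ)) ⟩
      (σ xor (σ ∧ ∑ m π)) xor ((σ ∧ ∑ m π) xor σ)
        ≡⟨ cancel-pairs σ (σ ∧ ∑ m π) ⟩
      false ∎

  halve : ∀ f → Periodic m f → ∀ Δ → (∀ s → 1 ≤ s → s ≤ p + p → C m f 0 - C m f s ≡ + 2 * Δ) →
          Σ (ℕ → ℤ) λ h → Periodic m h × (∀ s → 1 ≤ s → s ≤ p + p → + 4 * (C m h 0 - C m h s) ≡ + 2 * Δ)
  halve f per Δ gap = h , h-periodic , gap-h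
    where
    σ : Bool
    σ = parity (C m f 0)

    restore : ∀ a b → a ≡ b ℤ.+ (a - b)
    restore = solve-∀

    -- all gaps are even, so all autocorrelations have the parity of C(0)
    below-m : ∀ r → r < m → parity (C m f r) ≡ σ
    below-m zero    _           = refl
    below-m (suc r) (s≤s r≤2p)  = sym (parity-unique C₀≡₂Cᵣ)
      where
      C₀≡Cᵣ+2Δ : C m f 0 ≡ C m f (suc r) ℤ.+ + 2 * Δ
      C₀≡Cᵣ+2Δ = trans (restore (C m f 0) (C m f (suc r)))
                       (cong (λ z → C m f (suc r) ℤ.+ z) (gap (suc r) (s≤s z≤n) r≤2p))

      C₀≡₂Cᵣ : C m f 0 ≡₂ parity (C m f (suc r))
      C₀≡₂Cᵣ = subst (_≡₂ parity (C m f (suc r))) (sym C₀≡Cᵣ+2Δ) (≡₂-+even (parity-≡₂ (C m f (suc r))) Δ)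

    same-parity : ∀ s → parity (C m f s) ≡ σ
    same-parity s = trans (cong parity (periodic-% m (C-periodic m f per) s)) (below-m (s % m) (m%n<n s m))

    f≡₂σ : ∀ i → f i ≡₂ σ
    f≡₂σ = constant-mod-2 f per same-parity

    h : ℕ → ℤ
    h i = proj₁ (f≡₂σ i)

    f≡2h+σ : ∀ i → f i ≡ + 2 * h i ℤ.+ ⟦ σ ⟧
    f≡2h+σ i = proj₂ (f≡₂σ i)

    h-periodic : Periodic m h
    h-periodic j = *-cancelˡ-≡ (+ 2) _ _
      (∙-cancelʳ ⟦ σ ⟧ _ _ (trans (sym (f≡2h+σ (j + m))) (trans (per j) (f≡2h+σ j))))

    gap-h : ∀ s → 1 ≤ s → s ≤ p + p → + 4 * (C m h 0 - C m h s) ≡ + 2 * Δ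
    gap-h s 1≤s s≤2p = trans (sym (C-gap-affine m f h ⟦ σ ⟧ h-periodic f≡2h+σ s)) (gap s 1≤s s≤2p)

  -- No m-periodic integer sequence has all gaps C(0) - C(s), 0 < s < m, equal to
  -- 2·4^k·o with o odd: halving k times leaves a sequence whose gap 2o/4 is no integer.
  descent : ∀ k o → o ≡₂ true → ∀ f → Periodic m f →
            (∀ s → 1 ≤ s → s ≤ p + p → C m f 0 - C m f s ≡ + 2 * ((+ 4) ^ k * o)) → ⊥
  descent zero o (u , o≡2u+1) f per gap =
    let h , _ , gap-h = halve f per ((+ 4) ^ 0 * o) gap
        X = C m h 0 - C m h 1
    in even≢odd X u (*-cancelˡ-≡ (+ 2) _ _ (begin
      + 2 * (+ 2 * X)          ≡⟨ double X ⟩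
      + 4 * X                  ≡⟨ gap-h 1 (s≤s z≤n) (≤-trans (>-nonZero⁻¹ p) (m≤m+n p p)) ⟩
      + 2 * (+ 1 * o)          ≡⟨ cong (+ 2 *_) (trans (*-identityˡ o) o≡2u+1) ⟩
      + 2 * (+ 2 * u ℤ.+ + 1)  ∎))
    where
    double : ∀ x → + 2 * (+ 2 * x) ≡ + 4 * x
    double = solve-∀
  descent (suc k) o odd f per gap =
    let h , h-periodic , gap-h = halve f per ((+ 4) ^ suc k * o) gap
    in descent k o odd h h-periodic (λ s 1≤s s≤2p →
         *-cancelˡ-≡ (+ 4) _ _ (trans (gap-h s 1≤s s≤2p) (regroup ((+ 4) ^ k) o)))
    where
    regroup : ∀ a o → + 2 * (+ 4 * a * o) ≡ + 4 * (+ 2 * (a * o))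
    regroup = solve-∀

module Folding where

  open import Data.Nat using (ℕ; zero; suc; _+_; _*_; _∸_; _≤_; s≤s; s≤s⁻¹; z≤n)
  open import Data.Nat.Properties using (*-comm; *-zeroʳ; ≤-trans; m≤m+n; +-mono-≤; *-monoʳ-≤)
  open import Data.Nat.Tactic.RingSolver using (solve-∀)
  open import Data.Integer as ℤ using (ℤ; +_; _-_)
  open import Data.Integer.Properties using (pos-+)
  import Data.Integer.Tactic.RingSolver as ℤSolver
  open Periodicity
  open IntSum
  open Autocorrelation
  open ≡-Reasoning

  fold : ℕ → ℕ → (ℕ → ℤ) → ℕ → ℤ
  fold c d a r = ∑ d (λ k → a (r + c * k))

  residue-periodic : ∀ c d (a : ℕ → ℤ) → Periodic (c * d) a → ∀ r → Periodic d (λ k → a (r + c * k))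
  residue-periodic c d a per r k = periodic-≡ per 1 (identity r c k d)
    where
    identity : ∀ r c k d → r + c * (k + d) ≡ r + c * k + c * d * 1
    identity = solve-∀

  fold-periodic : ∀ c d (a : ℕ → ℤ) → Periodic (c * d) a → Periodic c (fold c d a)
  fold-periodic c d a per r =
    trans (∑-cong d (λ k → cong a (identity r c k))) (∑-shift d _ (residue-periodic c d a per r) 1)
    where
    identity : ∀ r c k → r + c + c * k ≡ r + c * (k + 1)
    identity = solve-∀

  C-by-residues : ∀ c d (a : ℕ → ℤ) t →
    C (c * d) a t ≡ ∑ c (λ r → ∑ d (λ k → a (r + c * k) ℤ.* a ((r + c * k) + t)))
  C-by-residues c d a t = begin
    ∑ (c * d) φ                                   ≡⟨ cong (λ n → ∑ n φ) (*-comm c d) ⟩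
    ∑ (d * c) φ                                   ≡⟨ ∑-blocks c d φ ⟩
    ∑ d (λ k → ∑ c (λ r → φ (k * c + r)))         ≡⟨ ∑-swap d c _ ⟩
    ∑ c (λ r → ∑ d (λ k → φ (k * c + r)))         ≡⟨ ∑-cong c (λ r → ∑-cong d (λ k → cong φ (identity k c r))) ⟩
    ∑ c (λ r → ∑ d (λ k → φ (r + c * k)))         ∎
    where
    φ : ℕ → ℤ
    φ i = a i ℤ.* a (i + t)
    identity : ∀ k c r → k * c + r ≡ r + c * k
    identity = solve-∀

  C-fold : ∀ c d (a : ℕ → ℤ) → Periodic (c * d) a → ∀ s →
           C c (fold c d a) s ≡ ∑ d (λ l → C (c * d) a (s + c * l))
  C-fold c d a per s = begin
    ∑ c (λ r → fold c d a r ℤ.* fold c d a (r + s))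
      ≡⟨ ∑-cong c (λ r → trans (sym (∑-scaleʳ _ d _))
                               (∑-cong d (λ k → cong (a (r + c * k) ℤ.*_) (realign r k)))) ⟩
    ∑ c (λ r → ∑ d (λ k → a (r + c * k) ℤ.* ∑ d (λ l → term r k l)))
      ≡⟨ ∑-cong c (λ r → ∑-cong d (λ k → sym (∑-scaleˡ (a (r + c * k)) d _))) ⟩
    ∑ c (λ r → ∑ d (λ k → ∑ d (λ l → a (r + c * k) ℤ.* term r k l)))
      ≡⟨ ∑-cong c (λ r → ∑-swap d d _) ⟩
    ∑ c (λ r → ∑ d (λ l → ∑ d (λ k → a (r + c * k) ℤ.* term r k l)))
      ≡⟨ ∑-swap c d _ ⟩
    ∑ d (λ l → ∑ c (λ r → ∑ d (λ k → a (r + c * k) ℤ.* term r k l)))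
      ≡⟨ ∑-cong d (λ l → sym (C-by-residues c d a (s + c * l))) ⟩
    ∑ d (λ l → C (c * d) a (s + c * l)) ∎
    where
    term : ℕ → ℕ → ℕ → ℤ
    term r k l = a ((r + c * k) + (s + c * l))

    reshuffle : ∀ r s c l k → r + s + c * (l + k) ≡ (r + c * k) + (s + c * l)
    reshuffle = solve-∀

    realign : ∀ r k → fold c d a (r + s) ≡ ∑ d (λ l → term r k l)
    realign r k = trans (sym (∑-shift d _ (residue-periodic c d a per (r + s)) k))
                        (∑-cong d (λ l → cong a (reshuffle r s c l k)))

  fold-gap : ∀ c' d' (a : ℕ → ℤ) → Periodic (suc c' * suc d') a →
    C (suc c' * suc d') a 0 ≡ + (suc c' * suc d') →
    (∀ t → 1 ≤ t → t ≤ suc c' * suc d' ∸ 1 → C (suc c' * suc d') a t ≡ + 3) →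
    ∀ s → 1 ≤ s → s ≤ c' →
    C (suc c') (fold (suc c') (suc d') a) 0 - C (suc c') (fold (suc c') (suc d') a) s
      ≡ + (suc c' * suc d') - + 3
  fold-gap c' d' a per peak off-peak s 1≤s s≤c' = begin
    C c (fold c d a) 0 - C c (fold c d a) s
      ≡⟨ cong₂ _-_ (C-fold c d a per 0) (C-fold c d a per s) ⟩
    ∑ d (λ l → C n a (0 + c * l)) - ∑ d (λ l → C n a (s + c * l))
      ≡⟨ cong₂ _-_ folded-peak folded-off-peak ⟩
    (+ n ℤ.+ + (d' * 3)) - + (3 + d' * 3)
      ≡⟨ cong (λ z → (+ n ℤ.+ + (d' * 3)) - z) (pos-+ 3 (d' * 3)) ⟩
    (+ n ℤ.+ + (d' * 3)) - (+ 3 ℤ.+ + (d' * 3))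
      ≡⟨ simplify (+ n) (+ (d' * 3)) ⟩
    + n - + 3 ∎
    where
    c d n : ℕ
    c = suc c'
    d = suc d'
    n = c * d

    simplify : ∀ x y → (x ℤ.+ y) - (+ 3 ℤ.+ y) ≡ x - + 3
    simplify = ℤSolver.solve-∀

    -- n - 1 = c' + c·d' is the largest off-peak shift
    in-range : ∀ s l → s ≤ c' → l ≤ d' → s + c * l ≤ n ∸ 1
    in-range s l s≤c' l≤d' = subst (s + c * l ≤_) (last c' d') (+-mono-≤ s≤c' (*-monoʳ-≤ c l≤d'))
      where
      last : ∀ c' d' → c' + suc c' * d' ≡ d' + c' * suc d'
      last = solve-∀

    folded-peak : ∑ d (λ l → C n a (0 + c * l)) ≡ + n ℤ.+ + (d' * 3)
    folded-peak = trans (∑-front d' _) (cong₂ ℤ._+_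
      (trans (cong (λ z → C n a z) (*-zeroʳ c)) peak)
      (trans (∑-cong< d' (λ l l<d' → off-peak _ (s≤s z≤n) (in-range 0 (suc l) z≤n l<d'))) (∑-const d' 3)))

    folded-off-peak : ∑ d (λ l → C n a (s + c * l)) ≡ + (3 + d' * 3)
    folded-off-peak = trans (∑-cong< d (λ l l<d →
                              off-peak _ (≤-trans 1≤s (m≤m+n s _)) (in-range s l s≤c' (s≤s⁻¹ l<d))))
                            (∑-const d 3)

open import Defs
open import Data.Nat using (ℕ; _≤_; _*_; _+_; _∸_; suc; _^_; NonZero)
open import Data.Nat.DivMod using (_/_)
open import Data.Integer using (ℤ; +_; -[1+_]; _-_)
open import Data.Product using (_×_; _,_)
open import Data.Sum using (_⊎_; inj₁; inj₂)
open import Relation.Nullary using (¬_)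
open import Data.Bool using (true)
open Parity using (_≡₂_)
open Autocorrelation using (C)
open Folding using (fold; fold-periodic; fold-gap)

autocorr≡C : ∀ n a t → autocorr n a t ≡ C n a t
autocorr≡C n a t = sumTo≡∑ n _
  where
  sumTo≡∑ : ∀ n f → sumTo n f ≡ IntSum.∑ n f
  sumTo≡∑ ℕ.zero    f = refl
  sumTo≡∑ (ℕ.suc n) f = cong (ℤ._+ f n) (sumTo≡∑ n f)

binary-peak : ∀ n a → IsBinary a → C n a 0 ≡ + n
binary-peak n a binary =
  trans (IntSum.∑-cong n square) (trans (Autocorrelation.∑-const n 1) (cong +_ (ℕP.*-identityʳ n)))
  where
  unit-square : ∀ {x} → x ≡ -[1+ 0 ] ⊎ x ≡ + 1 → x ℤ.* x ≡ + 1
  unit-square (inj₁ refl) = refl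
  unit-square (inj₂ refl) = refl

  square : ∀ i → a i ℤ.* a (i + 0) ≡ + 1
  square i = trans (cong (λ j → a i ℤ.* a j) (ℕP.+-identityʳ i)) (unit-square (binary i))

no-sequence : ∀ p .{{_ : NonZero p}} e t → suc p ^ e ≡ p + p + suc (p + p) * t →
  ∀ d k o → o ≡₂ true → + (suc (p + p) * suc d) - + 3 ≡ + 2 ℤ.* ((+ 4) ℤ.^ k ℤ.* o) →
  ∀ a → IsBinary a → HasPeriod (suc (p + p) * suc d) a →
  ¬ (∀ t → 1 ≤ t → t ≤ suc (p + p) * suc d ∸ 1 → autocorr (suc (p + p) * suc d) a t ≡ + 3)
no-sequence p e t inverse-power d k o odd n-3≡gap a binary per off-peak =
  Descent.descent p e t inverse-power k o odd (fold m (suc d) a) (fold-periodic m (suc d) a per)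
    (λ s 1≤s s≤2p → trans (fold-gap (p + p) d a per (binary-peak n a binary) off-peak′ s 1≤s s≤2p) n-3≡gap)
  where
  m n : ℕ
  m = suc (p + p)
  n = m * suc d
  off-peak′ : ∀ t → 1 ≤ t → t ≤ n ∸ 1 → C n a t ≡ + 3
  off-peak′ t 1≤t t≤n-1 = trans (sym (autocorr≡C n a t)) (off-peak t 1≤t t≤n-1)

-- The four cases, with data (p, e, t, d, k, o): n = 931 = 19·49 is folded onto
-- m = 19, where 10^9 ≡ -1; n = 1123, 1483, 1723 are prime and used directly (d = 0).
lemma4p6 : (A : ℕ) → (A ≡ 61 ⊎ A ≡ 67 ⊎ A ≡ 77 ⊎ A ≡ 83) →
    ∀ (a : ℕ → ℤ) → IsBinary a → HasPeriod ((A * A + 3) / 4) a →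
    ¬ (∀ t → 1 ≤ t → t ≤ (A * A + 3) / 4 ∸ 1 → autocorr ((A * A + 3) / 4) a t ≡ + 3)
lemma4p6 .61 (inj₁ refl)               = no-sequence 9 9 (10 ^ 9 / 19) refl 48 2 (+ 29) (+ 14 , refl) refl
lemma4p6 .67 (inj₂ (inj₁ refl))        = no-sequence 561 561 (562 ^ 561 / 1123) refl 0 2 (+ 35) (+ 17 , refl) refl
lemma4p6 .77 (inj₂ (inj₂ (inj₁ refl))) = no-sequence 741 741 (742 ^ 741 / 1483) refl 0 1 (+ 185) (+ 92 , refl) refl
lemma4p6 .83 (inj₂ (inj₂ (inj₂ refl))) = no-sequence 861 287 (862 ^ 287 / 1723) refl 0 1 (+ 215) (+ 107 , refl) refl
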